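{- Let $p,r,k$ be positive integers. Then $$R_{p,r}(k) = \frac{r}{kp+r}\binom{kp+r}{k} = \sum_\lambda \binom{r}{\lambda_1} \binom{p \lambda_1}{\lambda_2} \binom{p \lambda_2}{\lambda_3} \cdots \binom{p \lambda_{j-1}}{\lambda_j},$$ where $\lambda = (\lambda_1,\lambda_2,\dots,\lambda_j)$ ranges over all ordered partitions (compositions) of $k$ into positive parts, of any length $j \geq 1$.
   Context: $R_{p,r}(n) = \frac{r}{np+r}\binom{np+r}{n}$ denotes the Raney number. -}

module Defs where

open import Data.Nat using (ℕ; zero; suc; _+_; _*_; _∸_)
open import Data.Nat.Combinatorics using (_C_)
open import Data.List using (List; []; _∷_; map; concatMap; upTo)
open import Data.Nat.ListAction using (sum)
open import Data.Integer using (+_)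
open import Data.Rational using (ℚ; _/_; 0ℚ)
import Data.Rational as ℚ

-- a / d as a rational; only used with d ≠ 0 (the value at d = 0 is a junk 0).
frac : ℕ → ℕ → ℚ
frac a zero = 0ℚ
frac a (suc d) = (+ a) / suc d

toℚ : ℕ → ℚ
toℚ n = (+ n) / 1

Raney : (p r n : ℕ) → ℚ
Raney p r n = frac r (n * p + r) ℚ.* toℚ ((n * p + r) C n)

-- compositionsF f k : all lists of positive naturals summing to k,
-- with fuel f ≥ k ensuring structural termination.
-- First part is suc i (0 ≤ i < k), followed by a composition of k ∸ suc i.
compositionsF : ℕ → ℕ → List (List ℕ)
compositionsF _ zero = [] ∷ []
compositionsF zero (suc k) = []
compositionsF (suc f) (suc k) =
  concatMap (λ i → map (suc i ∷_) (compositionsF f (suc k ∸ suc i))) (upTo (suc k))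

compositions : ℕ → List (List ℕ)
compositions k = compositionsF k k

chain : ℕ → ℕ → List ℕ → ℕ
chain p a [] = 1
chain p a (l ∷ ls) = ((p * a) C l) * chain p l ls

raneyTerm : ℕ → ℕ → List ℕ → ℕ
raneyTerm p r [] = 1
raneyTerm p r (l ∷ ls) = (r C l) * chain p l ls

compositionSum : ℕ → ℕ → ℕ → ℕ
compositionSum p r k = sum (map (raneyTerm p r) (compositions k))

-- Write T(a, k) for the sum over compositions of k of C(a, λ₁) C(pλ₁, λ₂) ⋯ C(pλ_{j-1}, λ_j).
-- Splitting off the first part λ₁ = i + 1 gives T(a, k) = Σᵢ C(a, i+1) T(p(i+1), k-1-i),
-- and the claim (kp + a) T(a, k) = a C(kp + a, k) follows by induction on k: for the tails
-- the hypothesis reads k T(p(i+1), k-1-i) = (i+1) C(kp, k-1-i), absorption turns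
-- C(a, i+1)(i+1) into a C(a-1, i), and what remains is a Vandermonde convolution.

module Submission where

open import Defs
open import Data.Nat using (ℕ; zero; suc; _+_; _*_; _∸_; _≤_; _<_; _≥_; z≤n; s≤s; NonZero; >-nonZero)
open import Data.Nat.Properties
open import Data.Nat.Combinatorics using (_C_; nC1≡n; nCk+nC[k+1]≡[n+1]C[k+1])
open import Data.List using (List; []; _∷_; map; concatMap; applyUpTo; upTo; _++_)
open import Data.List.Properties using (map-++)
open import Data.Nat.ListAction using (sum)
open import Data.Nat.ListAction.Properties using (sum-++)
import Data.Integer as ℤ
import Data.Integer.Properties as ℤ
import Data.Rational as ℚ
open import Data.Rational.Properties using (toℚᵘ-injective; toℚᵘ-homo-*; toℚᵘ-fromℚᵘ)
open import Data.Rational.Unnormalised using (mkℚᵘ; *≡*)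
import Data.Rational.Unnormalised as ℚᵘ
import Data.Rational.Unnormalised.Properties as ℚᵘ
open import Relation.Binary.PropositionalEquality using (_≡_; refl; sym; trans; cong; cong₂; subst; module ≡-Reasoning)
import Algebra.Properties.CommutativeSemigroup as CommSemigroupProperties
open CommSemigroupProperties +-commutativeSemigroup using ()
  renaming (interchange to +-interchange; x∙yz≈y∙xz to x+[y+z]≡y+[x+z])
open CommSemigroupProperties *-commutativeSemigroup using ()
  renaming (x∙yz≈y∙xz to x*[y*z]≡y*[x*z])

∑< : ℕ → (ℕ → ℕ) → ℕ
∑< zero    f = 0
∑< (suc n) f = f 0 + ∑< n (λ i → f (suc i))

infix 6.5 ∑<
syntax ∑< n (λ i → x) = ∑[ i < n ] x

∑<-cong : ∀ n {f g : ℕ → ℕ} → (∀ i → i < n → f i ≡ g i) → ∑< n f ≡ ∑< n g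
∑<-cong zero    f≗g = refl
∑<-cong (suc n) f≗g = cong₂ _+_ (f≗g 0 (s≤s z≤n)) (∑<-cong n (λ i i<n → f≗g (suc i) (s≤s i<n)))

∑<-zero : ∀ n → ∑[ i < n ] 0 ≡ 0
∑<-zero zero    = refl
∑<-zero (suc n) = ∑<-zero n

∑<-distrib-+ : ∀ n (f g : ℕ → ℕ) → ∑[ i < n ] (f i + g i) ≡ ∑< n f + ∑< n g
∑<-distrib-+ zero    f g = refl
∑<-distrib-+ (suc n) f g =
  trans (cong (f 0 + g 0 +_) (∑<-distrib-+ n _ _)) (+-interchange (f 0) (g 0) _ _)

*-distribˡ-∑< : ∀ x n (f : ℕ → ℕ) → x * ∑< n f ≡ ∑[ i < n ] x * f i
*-distribˡ-∑< x zero    f = *-zeroʳ x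
*-distribˡ-∑< x (suc n) f = trans (*-distribˡ-+ x (f 0) _) (cong (x * f 0 +_) (*-distribˡ-∑< x n _))

[k+1]*[n+1]C[k+1]≡[n+1]*nCk : ∀ n k → suc k * (suc n C suc k) ≡ suc n * (n C k)
[k+1]*[n+1]C[k+1]≡[n+1]*nCk zero    zero    = refl
[k+1]*[n+1]C[k+1]≡[n+1]*nCk zero    (suc k) = *-zeroʳ (suc (suc k))
[k+1]*[n+1]C[k+1]≡[n+1]*nCk (suc n) zero    = trans (*-identityˡ _) (trans (nC1≡n (suc (suc n))) (sym (*-identityʳ _)))
[k+1]*[n+1]C[k+1]≡[n+1]*nCk (suc n) (suc k) = begin
  suc (suc k) * (suc (suc n) C suc (suc k))            ≡⟨ cong (suc (suc k) *_) (nCk+nC[k+1]≡[n+1]C[k+1] (suc n) (suc k)) ⟨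
  suc (suc k) * (X + Y)                                ≡⟨ *-distribˡ-+ (suc (suc k)) X Y ⟩
  (X + suc k * X) + suc (suc k) * Y                    ≡⟨ +-assoc X (suc k * X) _ ⟩
  X + (suc k * X + suc (suc k) * Y)                    ≡⟨ cong (X +_) (cong₂ _+_ ([k+1]*[n+1]C[k+1]≡[n+1]*nCk n k)
                                                                              ([k+1]*[n+1]C[k+1]≡[n+1]*nCk n (suc k))) ⟩
  X + (suc n * (n C k) + suc n * (n C suc k))          ≡⟨ cong (X +_) (*-distribˡ-+ (suc n) (n C k) (n C suc k)) ⟨
  X + suc n * (n C k + n C suc k)                      ≡⟨ cong (λ y → X + suc n * y) (nCk+nC[k+1]≡[n+1]C[k+1] n k) ⟩
  suc (suc n) * X                                      ∎
  where
  open ≡-Reasoning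
  X Y : ℕ
  X = suc n C suc k
  Y = suc n C suc (suc k)

vandermonde : ∀ a b m → ∑[ i < suc m ] (a C i) * (b C (m ∸ i)) ≡ (a + b) C m
vandermonde zero    b m       = trans (cong₂ _+_ (*-identityˡ (b C m)) (∑<-zero m)) (+-identityʳ (b C m))
vandermonde (suc a) b zero    = refl
vandermonde (suc a) b (suc m) = begin
  1 * (b C suc m) + ∑[ i < suc m ] (suc a C suc i) * (b C (m ∸ i))  ≡⟨ cong (1 * (b C suc m) +_) pascal-split ⟩
  1 * (b C suc m) + (lower + shifted)                              ≡⟨ x+[y+z]≡y+[x+z] (1 * (b C suc m)) lower shifted ⟩
  lower + (1 * (b C suc m) + shifted)                              ≡⟨ cong₂ _+_ (vandermonde a b m) (vandermonde a b (suc m)) ⟩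
  (a + b) C m + (a + b) C suc m                                    ≡⟨ nCk+nC[k+1]≡[n+1]C[k+1] (a + b) m ⟩
  suc (a + b) C suc m                                              ∎
  where
  open ≡-Reasoning
  lower shifted : ℕ
  lower   = ∑[ i < suc m ] (a C i) * (b C (m ∸ i))
  shifted = ∑[ i < suc m ] (a C suc i) * (b C (m ∸ i))

  pascal-split : ∑[ i < suc m ] (suc a C suc i) * (b C (m ∸ i)) ≡ lower + shifted
  pascal-split = trans
    (∑<-cong (suc m) λ i _ → trans (cong (_* (b C (m ∸ i))) (sym (nCk+nC[k+1]≡[n+1]C[k+1] a i)))
                                   (*-distribʳ-+ (b C (m ∸ i)) (a C i) (a C suc i)))
    (∑<-distrib-+ (suc m) (λ i → (a C i) * (b C (m ∸ i))) (λ i → (a C suc i) * (b C (m ∸ i))))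

sum-map-concatMap : ∀ {A B : Set} (h : B → ℕ) (g : A → List B) xs →
                    sum (map h (concatMap g xs)) ≡ sum (map (λ x → sum (map h (g x))) xs)
sum-map-concatMap h g []       = refl
sum-map-concatMap h g (x ∷ xs) = begin
  sum (map h (g x ++ concatMap g xs))                  ≡⟨ cong sum (map-++ h (g x) (concatMap g xs)) ⟩
  sum (map h (g x) ++ map h (concatMap g xs))          ≡⟨ sum-++ (map h (g x)) (map h (concatMap g xs)) ⟩
  sum (map h (g x)) + sum (map h (concatMap g xs))     ≡⟨ cong (sum (map h (g x)) +_) (sum-map-concatMap h g xs) ⟩
  sum (map h (g x)) + sum (map (λ x → sum (map h (g x))) xs) ∎
  where open ≡-Reasoning

sum-map-applyUpTo : ∀ (h g : ℕ → ℕ) n → sum (map h (applyUpTo g n)) ≡ ∑[ i < n ] h (g i)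
sum-map-applyUpTo h g zero    = refl
sum-map-applyUpTo h g (suc n) = cong (h (g 0) +_) (sum-map-applyUpTo h (λ i → g (suc i)) n)

module _ (p : ℕ) where

  compositionSumF : (a f k : ℕ) → ℕ
  compositionSumF a f k = sum (map (raneyTerm p a) (compositionsF f k))

  raneyTerm-∷ : ∀ a l ls → raneyTerm p a (l ∷ ls) ≡ (a C l) * raneyTerm p (p * l) ls
  raneyTerm-∷ a l []       = refl
  raneyTerm-∷ a l (_ ∷ _) = refl

  sum-raneyTerm-∷ : ∀ a l lss →
    sum (map (raneyTerm p a) (map (l ∷_) lss)) ≡ (a C l) * sum (map (raneyTerm p (p * l)) lss)
  sum-raneyTerm-∷ a l []         = sym (*-zeroʳ (a C l))
  sum-raneyTerm-∷ a l (ls ∷ lss) = begin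
    raneyTerm p a (l ∷ ls) + sum (map (raneyTerm p a) (map (l ∷_) lss))
      ≡⟨ cong₂ _+_ (raneyTerm-∷ a l ls) (sum-raneyTerm-∷ a l lss) ⟩
    (a C l) * raneyTerm p (p * l) ls + (a C l) * sum (map (raneyTerm p (p * l)) lss)
      ≡⟨ *-distribˡ-+ (a C l) _ _ ⟨
    (a C l) * sum (map (raneyTerm p (p * l)) (ls ∷ lss))
      ∎
    where open ≡-Reasoning

  compositionSumF-suc : ∀ a f m →
    compositionSumF a (suc f) (suc m) ≡ ∑[ i < suc m ] (a C suc i) * compositionSumF (p * suc i) f (m ∸ i)
  compositionSumF-suc a f m = begin
    sum (map (raneyTerm p a) (concatMap firstPart (upTo (suc m))))
      ≡⟨ sum-map-concatMap (raneyTerm p a) firstPart (upTo (suc m)) ⟩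
    sum (map (λ i → sum (map (raneyTerm p a) (firstPart i))) (upTo (suc m)))
      ≡⟨ sum-map-applyUpTo (λ i → sum (map (raneyTerm p a) (firstPart i))) (λ i → i) (suc m) ⟩
    ∑[ i < suc m ] sum (map (raneyTerm p a) (firstPart i))
      ≡⟨ ∑<-cong (suc m) (λ i _ → sum-raneyTerm-∷ a (suc i) (compositionsF f (m ∸ i))) ⟩
    ∑[ i < suc m ] (a C suc i) * compositionSumF (p * suc i) f (m ∸ i)
      ∎
    where
    open ≡-Reasoning
    firstPart : ℕ → List (List ℕ)
    firstPart i = map (suc i ∷_) (compositionsF f (m ∸ i))

  compositionSumF-closedForm : .{{_ : NonZero p}} → ∀ f k a → k ≤ f →
    (k * p + a) * compositionSumF a f k ≡ a * ((k * p + a) C k)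
  compositionSumF-closedForm f       zero    a       _ = refl
  compositionSumF-closedForm (suc f) (suc m) zero    _ =
    trans (cong ((suc m * p + 0) *_) (trans (compositionSumF-suc 0 f m) (∑<-zero (suc m))))
          (*-zeroʳ (suc m * p + 0))
  compositionSumF-closedForm (suc f) (suc m) (suc b) (s≤s m≤f) = *-cancelˡ-≡ _ _ (suc m) (begin
    suc m * ((M + suc b) * S)                    ≡⟨ x*[y*z]≡y*[x*z] (suc m) (M + suc b) S ⟩
    (M + suc b) * (suc m * S)                    ≡⟨ cong₂ _*_ M+1+b≡1+b+M weighted ⟩
    suc (b + M) * (suc b * ((b + M) C m))        ≡⟨ x*[y*z]≡y*[x*z] (suc (b + M)) (suc b) _ ⟩
    suc b * (suc (b + M) * ((b + M) C m))        ≡⟨ cong (suc b *_) ([k+1]*[n+1]C[k+1]≡[n+1]*nCk (b + M) m) ⟨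
    suc b * (suc m * (suc (b + M) C suc m))      ≡⟨ x*[y*z]≡y*[x*z] (suc b) (suc m) _ ⟩
    suc m * (suc b * (suc (b + M) C suc m))      ≡⟨ cong (λ n → suc m * (suc b * (n C suc m))) M+1+b≡1+b+M ⟨
    suc m * (suc b * ((M + suc b) C suc m))      ∎)
    where
    open ≡-Reasoning
    M S : ℕ
    M = suc m * p
    S = compositionSumF (suc b) (suc f) (suc m)

    T : ℕ → ℕ
    T i = compositionSumF (p * suc i) f (m ∸ i)

    M+1+b≡1+b+M : M + suc b ≡ suc (b + M)
    M+1+b≡1+b+M = trans (+-suc M b) (cong suc (+-comm M b))

    -- Cancelling p from the induction hypothesis is where p ≠ 0 is needed.
    tail-closedForm : ∀ i → i ≤ m → suc m * T i ≡ suc i * (M C (m ∸ i))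
    tail-closedForm i i≤m = *-cancelˡ-≡ _ _ p (begin
      p * (suc m * T i)      ≡⟨ *-assoc p (suc m) (T i) ⟨
      p * suc m * T i        ≡⟨ cong (_* T i) (*-comm p (suc m)) ⟩
      M * T i                ≡⟨ subst (λ n → n * T i ≡ p * suc i * (n C (m ∸ i))) parts≡M
                                      (compositionSumF-closedForm f (m ∸ i) (p * suc i) (≤-trans (m∸n≤m m i) m≤f)) ⟩
      p * suc i * (M C (m ∸ i))  ≡⟨ *-assoc p (suc i) _ ⟩
      p * (suc i * (M C (m ∸ i))) ∎)
      where
      parts≡M : (m ∸ i) * p + p * suc i ≡ M
      parts≡M = begin
        (m ∸ i) * p + p * suc i    ≡⟨ cong ((m ∸ i) * p +_) (*-comm p (suc i)) ⟩
        (m ∸ i) * p + suc i * p    ≡⟨ *-distribʳ-+ p (m ∸ i) (suc i) ⟨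
        (m ∸ i + suc i) * p        ≡⟨ cong (_* p) (trans (+-suc (m ∸ i) i) (cong suc (m∸n+n≡m i≤m))) ⟩
        M                          ∎

    weighted : suc m * S ≡ suc b * ((b + M) C m)
    weighted = begin
      suc m * S
        ≡⟨ cong (suc m *_) (compositionSumF-suc (suc b) f m) ⟩
      suc m * (∑[ i < suc m ] (suc b C suc i) * T i)
        ≡⟨ *-distribˡ-∑< (suc m) (suc m) (λ i → (suc b C suc i) * T i) ⟩
      ∑[ i < suc m ] suc m * ((suc b C suc i) * T i)
        ≡⟨ ∑<-cong (suc m) (λ i i<1+m → term i (m<1+n⇒m≤n i<1+m)) ⟩
      ∑[ i < suc m ] suc b * ((b C i) * (M C (m ∸ i)))
        ≡⟨ *-distribˡ-∑< (suc b) (suc m) (λ i → (b C i) * (M C (m ∸ i))) ⟨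
      suc b * (∑[ i < suc m ] (b C i) * (M C (m ∸ i)))
        ≡⟨ cong (suc b *_) (vandermonde b M m) ⟩
      suc b * ((b + M) C m)
        ∎
      where
      term : ∀ i → i ≤ m →
        suc m * ((suc b C suc i) * T i) ≡ suc b * ((b C i) * (M C (m ∸ i)))
      term i i≤m = begin
        suc m * ((suc b C suc i) * T i)
          ≡⟨ x*[y*z]≡y*[x*z] (suc m) (suc b C suc i) _ ⟩
        (suc b C suc i) * (suc m * T i)
          ≡⟨ cong ((suc b C suc i) *_) (tail-closedForm i i≤m) ⟩
        (suc b C suc i) * (suc i * (M C (m ∸ i)))
          ≡⟨ *-assoc (suc b C suc i) (suc i) _ ⟨
        (suc b C suc i) * suc i * (M C (m ∸ i))
          ≡⟨ cong (_* (M C (m ∸ i))) (trans (*-comm (suc b C suc i) (suc i)) ([k+1]*[n+1]C[k+1]≡[n+1]*nCk b i)) ⟩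
        suc b * (b C i) * (M C (m ∸ i))
          ≡⟨ *-assoc (suc b) (b C i) _ ⟩
        suc b * ((b C i) * (M C (m ∸ i)))
          ∎

frac-*-toℚ : ∀ a d c t .{{_ : NonZero d}} → d * t ≡ a * c → frac a d ℚ.* toℚ c ≡ toℚ t
frac-*-toℚ a (suc d) c t dt≡ac = toℚᵘ-injective (begin
    ℚ.toℚᵘ (frac a (suc d) ℚ.* toℚ c)
  ≈⟨ toℚᵘ-homo-* (frac a (suc d)) (toℚ c) ⟩
    ℚ.toℚᵘ (frac a (suc d)) ℚᵘ.* ℚ.toℚᵘ (toℚ c)
  ≈⟨ ℚᵘ.*-cong (toℚᵘ-fromℚᵘ (mkℚᵘ (ℤ.+ a) d)) (toℚᵘ-fromℚᵘ (mkℚᵘ (ℤ.+ c) 0)) ⟩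
    mkℚᵘ (ℤ.+ a) d ℚᵘ.* mkℚᵘ (ℤ.+ c) 0
  ≈⟨ *≡* cross ⟩
    mkℚᵘ (ℤ.+ t) 0
  ≈⟨ toℚᵘ-fromℚᵘ (mkℚᵘ (ℤ.+ t) 0) ⟨
    ℚ.toℚᵘ (toℚ t)
  ∎)
  where
  open ℚᵘ.≃-Reasoning
  cross : ℤ.+ a ℤ.* ℤ.+ c ℤ.* ℤ.+ 1 ≡ ℤ.+ t ℤ.* ℤ.+ (suc d * 1)
  cross = trans (ℤ.*-identityʳ (ℤ.+ a ℤ.* ℤ.+ c))
         (trans (sym (ℤ.pos-* a c))
         (trans (cong ℤ.+_ (trans (sym dt≡ac) (trans (*-comm (suc d) t) (cong (t *_) (sym (*-identityʳ (suc d)))))))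
                (ℤ.pos-* t (suc d * 1))))

theorem2p6 : (p r k : ℕ) → p ≥ 1 → r ≥ 1 → k ≥ 1 →
    Raney p r k ≡ toℚ (compositionSum p r k)
theorem2p6 p r k p≥1 r≥1 _ =
  frac-*-toℚ r (k * p + r) ((k * p + r) C k) (compositionSum p r k)
             (compositionSumF-closedForm p k k r ≤-refl)
  where instance
    _ : NonZero p
    _ = >-nonZero p≥1
    _ : NonZero (k * p + r)
    _ = >-nonZero (<-≤-trans r≥1 (m≤n+m r (k * p)))
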